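{- For $n\ge1$ let $\mathbb{G}_n$ be the multigraph on vertices $v_1,v_1',\dots,v_n,v_n'$ whose edges are: for each $k=1,\dots,n-1$, the four edges $v_kv_{k+1}$, $v_kv_{k+1}'$, $v_k'v_{k+1}$, $v_k'v_{k+1}'$; and two parallel edges between $v_n$ and $v_n'$; with every edge having resistance $1$. Then \[K\!f(\mathbb{G}_n)=\begin{cases}\dfrac{1}{6}(n^3+3n^2+n), & n\ge 2,\\[1ex] \dfrac12, & n=1.\end{cases}\]
   Context: For a connected multigraph whose edges $e$ carry positive resistances $r_e$, the Laplacian $L$ has $L_{uu}=\sum_{e\ni u}1/r_e$ and, for $u\ne v$, $L_{uv}=-\sum_{e \text{ joining } u,v}1/r_e$. The resistance distance between vertices $u,v$ is $\Omega(u,v)=(\mathbf{e}_u-\mathbf{e}_v)^TL^{\dagger}(\mathbf{e}_u-\mathbf{e}_v)$, with $L^\dagger$ the Moore–Penrose inverse (the effective resistance between $u$ and $v$ in the resistor network). The Kirchhoff index is $K\!f=\sum_{\{u,v\}}\Omega(u,v)$ over all unordered pairs of distinct vertices. -}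

module Defs where

open import Data.Nat as ℕ using (ℕ; zero; suc)
open import Data.Integer as ℤ using (ℤ)
open import Data.Fin using (Fin; inject₁; fromℕ) renaming (zero to fz; suc to fs)
open import Data.List using (List; []; _∷_; _++_; map; concatMap; foldr; allFin; cartesianProduct)
open import Data.Product using (_×_; _,_)
open import Data.Product.Properties using (≡-dec)
open import Data.Bool using (Bool; true; false; if_then_else_; _∧_; _∨_)
open import Relation.Nullary.Decidable using (Dec; ⌊_⌋)
open import Relation.Binary.PropositionalEquality using (_≡_)
open import Data.Rational using (ℚ; 0ℚ; 1ℚ; _+_; _*_; _-_; -_; 1/_; Positive)
open import Data.Rational.Properties using (pos⇒nonZero)
import Data.Fin.Properties as FinP

-- Finite vertex sets: a list enumerating all vertices (without repetition)
-- together with decidable equality.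

record FinVertexSet : Set₁ where
  field
    V    : Set
    all  : List V
    _≟_  : (u w : V) → Dec (u ≡ w)

  _==_ : V → V → Bool
  u == w = ⌊ u ≟ w ⌋

  Σᵥ : (V → ℚ) → ℚ
  Σᵥ f = foldr (λ v acc → f v + acc) 0ℚ all

-- Resistor multigraphs: a list of edges, each with two endpoints and a
-- positive resistance (parallel edges = repeated list entries).

record Edge (V : Set) : Set where
  constructor edge
  field
    end₁ end₂  : V
    resistance : ℚ
    {{pos}}    : Positive resistance

conductance : ∀ {V} → Edge V → ℚ
conductance (edge _ _ r {{p}}) = (1/ r) {{pos⇒nonZero r {{p}}}}

sumList : ∀ {A : Set} → (A → ℚ) → List A → ℚ
sumList f = foldr (λ x acc → f x + acc) 0ℚ

Matrix : Set → Set
Matrix V = V → V → ℚ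

module _ (S : FinVertexSet) where
  open FinVertexSet S

  laplacian : List (Edge V) → Matrix V
  laplacian es u w =
    if u == w
    then sumList (λ e → if (Edge.end₁ e == u) ∨ (Edge.end₂ e == u)
                        then conductance e else 0ℚ) es
    else - sumList (λ e → if ((Edge.end₁ e == u) ∧ (Edge.end₂ e == w))
                              ∨ ((Edge.end₁ e == w) ∧ (Edge.end₂ e == u))
                          then conductance e else 0ℚ) es

  _⊗_ : Matrix V → Matrix V → Matrix V
  (A ⊗ B) u w = Σᵥ (λ x → A u x * B x w)

  transpose : Matrix V → Matrix V
  transpose A u w = A w u

  _≈ₘ_ : Matrix V → Matrix V → Set
  A ≈ₘ B = ∀ u w → A u w ≡ B u w

  record IsMoorePenroseInverse (A X : Matrix V) : Set where
    field
      p₁ : ((A ⊗ X) ⊗ A) ≈ₘ A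
      p₂ : ((X ⊗ A) ⊗ X) ≈ₘ X
      p₃ : transpose (A ⊗ X) ≈ₘ (A ⊗ X)
      p₄ : transpose (X ⊗ A) ≈ₘ (X ⊗ A)

  basis : V → V → ℚ
  basis u x = if u == x then 1ℚ else 0ℚ

  resistanceDistance : Matrix V → V → V → ℚ
  resistanceDistance X u w =
    Σᵥ (λ x → Σᵥ (λ y → d x * X x y * d y))
    where d : V → ℚ
          d x = basis u x - basis w x

  unorderedPairs : List V → List (V × V)
  unorderedPairs []       = []
  unorderedPairs (x ∷ xs) = map (λ y → (x , y)) xs ++ unorderedPairs xs

  kirchhoffIndex : Matrix V → ℚ
  kirchhoffIndex X = sumList (λ { (u , w) → resistanceDistance X u w })
                             (unorderedPairs all)

-- The graph 𝔾_n for n = suc m ≥ 1.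
-- Vertex (k , 0) is v_{k+1}, vertex (k , 1) is v'_{k+1}.

GVerts : ℕ → FinVertexSet
GVerts n = record
  { V   = Fin n × Fin 2
  ; all = cartesianProduct (allFin n) (allFin 2)
  ; _≟_ = ≡-dec FinP._≟_ FinP._≟_
  }

GEdges : (m : ℕ) → List (Edge (Fin (suc m) × Fin 2))
GEdges m =
  concatMap (λ k → concatMap (λ a → map (λ b → edge (inject₁ k , a) (fs k , b) 1ℚ)
                                         (allFin 2))
                             (allFin 2))
            (allFin m)
  ++ (edge (fromℕ m , fz) (fromℕ m , fs fz) 1ℚ
   ∷ edge (fromℕ m , fz) (fromℕ m , fs fz) 1ℚ ∷ [])

GLaplacian : (m : ℕ) → Matrix (Fin (suc m) × Fin 2)
GLaplacian m = laplacian (GVerts (suc m)) (GEdges m)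

kfFormula : ℕ → ℚ
kfFormula 1 = ℤ.+ 1 Data.Rational./ 2
kfFormula n = ℤ.+ (n ℕ.^ 3 ℕ.+ 3 ℕ.* n ℕ.^ 2 ℕ.+ n) Data.Rational./ 6

-- Instead of computing the pseudoinverse X we use potentials: if L y = e_u − e_w, the Penrose equation
-- L X L = L gives Ω(u, w) = (e_u − e_w)ᵀ X (e_u − e_w) = yᵀ L X L y = yᵀ L y = y u − y w. So if H u
-- solves L (H u) = e_u − e_root, then Ω(u, w) = H u u − H w u − H u w + H w w, and summing over pairs
-- gives Kf = N Σᵤ H u u − Σᵤ Σ_w H u w, N the number of vertices.
-- On the ladder write a vector on layer K as f K ± g K (even and odd under v_K ↔ v_K′). The Laplacian
-- acts on the even part as twice the Laplacian of the path of layers, where the potential is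
-- min(K, I) / 4, and on the odd part diagonally; so H is explicit, and the remaining sums over the
-- layers are polynomials in n.

module Submission where

open import Defs
open import Data.Nat using (ℕ; suc)
open import Relation.Binary.PropositionalEquality using (_≡_)

open import Data.Bool using (Bool; true; false; if_then_else_; _∧_; _∨_)
open import Data.Bool.Properties using (∨-comm; T-≡)
open import Data.Fin using (Fin; toℕ; zero; suc; inject₁; fromℕ)
import Data.Fin.Properties as FinP
import Data.Integer as ℤ
open import Data.Integer.Tactic.RingSolver using () renaming (solve-∀ to ℤ-solve)
open import Data.List using (List; []; _∷_; _++_; map; concatMap; tabulate; allFin; cartesianProduct)
open import Data.List.Membership.Propositional using (_∈_; _∉_)
open import Data.List.Membership.Propositional.Properties using (∈-allFin; ∈-cartesianProduct⁺)
open import Data.List.Properties using (map-tabulate)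
open import Data.List.Relation.Unary.All using (All; []; _∷_)
open import Data.List.Relation.Unary.All.Properties using (All¬⇒¬Any; ++⁺; concat⁺; map⁺; tabulate⁺)
open import Data.List.Relation.Unary.Any using (here; there)
open import Data.List.Relation.Unary.Unique.Propositional using (Unique; []; _∷_)
open import Data.List.Relation.Unary.Unique.Propositional.Properties using (allFin⁺; cartesianProduct⁺)
open import Data.Maybe using (Maybe; just; nothing)
import Data.Nat as ℕ
open import Data.Nat using (zero; _≡ᵇ_; _<ᵇ_; _⊓_)
open import Data.Nat.Properties using (<⇒<ᵇ; 1+n≢n; ⊓-idem; <⇒≤; m≤n⇒m⊓n≡m; m≥n⇒m⊓n≡n)
open import Data.Product using (_×_; _,_; proj₁; proj₂; uncurry)
open import Data.Rational using (ℚ; 0ℚ; 1ℚ; ½; _+_; _*_; _-_; -_; _/_; toℚᵘ)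
import Data.Rational.Properties as ℚ
open import Algebra.Bundles using (CommutativeMonoid)
open import Algebra.Properties.CommutativeSemigroup (CommutativeMonoid.commutativeSemigroup ℚ.+-0-commutativeMonoid)
  using () renaming (interchange to +-interchange)
open import Data.Rational.Unnormalised using (mkℚᵘ; *≡*) renaming (_≃_ to _≃ᵘ_)
import Data.Rational.Unnormalised.Properties as ℚᵘ
open import Function using (_∘_; id)
open import Function.Bundles using (Equivalence)
open import Level using (0ℓ)
open import Relation.Binary using (DecidableEquality)
open import Relation.Binary.PropositionalEquality using (refl; sym; trans; cong; cong₂; module ≡-Reasoning)
open import Relation.Nullary using (yes; no; ¬_)
open import Relation.Nullary.Decidable using (⌊_⌋)
open import Relation.Nullary.Negation using (contradiction)
open import Tactic.RingSolver using (solve-∀)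
open import Tactic.RingSolver.Core.AlmostCommutativeRing using (AlmostCommutativeRing; fromCommutativeRing)

ℚ-ring : AlmostCommutativeRing 0ℓ 0ℓ
ℚ-ring = fromCommutativeRing ℚ.+-*-commutativeRing 0≟_
  where
  0≟_ : ∀ x → Maybe (0ℚ ≡ x)
  0≟ x with 0ℚ ℚ.≟ x
  ... | yes 0≡x = just 0≡x
  ... | no _    = nothing

𝟙 : Bool → ℚ
𝟙 b = if b then 1ℚ else 0ℚ

𝟙-∧ : ∀ b c → 𝟙 (b ∧ c) ≡ 𝟙 b * 𝟙 c
𝟙-∧ true  c = sym (ℚ.*-identityˡ (𝟙 c))
𝟙-∧ false c = sym (ℚ.*-zeroˡ (𝟙 c))

private variable
  A B : Set

sumList-cong : ∀ {f g : A → ℚ} xs → (∀ x → f x ≡ g x) → sumList f xs ≡ sumList g xs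
sumList-cong []       f≗g = refl
sumList-cong (x ∷ xs) f≗g = cong₂ _+_ (f≗g x) (sumList-cong xs f≗g)

sumList-+ : ∀ (f g : A → ℚ) xs → sumList (λ x → f x + g x) xs ≡ sumList f xs + sumList g xs
sumList-+ f g []       = refl
sumList-+ f g (x ∷ xs) = trans (cong (f x + g x +_) (sumList-+ f g xs)) (+-interchange (f x) (g x) _ _)

sumList-zero : ∀ (xs : List A) → sumList (λ _ → 0ℚ) xs ≡ 0ℚ
sumList-zero []       = refl
sumList-zero (x ∷ xs) = cong (0ℚ +_) (sumList-zero xs)

sumList-*ˡ : ∀ c (f : A → ℚ) xs → sumList (λ x → c * f x) xs ≡ c * sumList f xs
sumList-*ˡ c f []       = sym (ℚ.*-zeroʳ c)
sumList-*ˡ c f (x ∷ xs) =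
  trans (cong (c * f x +_) (sumList-*ˡ c f xs)) (sym (ℚ.*-distribˡ-+ c (f x) _))

sumList-*ʳ : ∀ c (f : A → ℚ) xs → sumList (λ x → f x * c) xs ≡ sumList f xs * c
sumList-*ʳ c f xs = trans (sumList-cong xs (λ x → ℚ.*-comm (f x) c))
                          (trans (sumList-*ˡ c f xs) (ℚ.*-comm c _))

sumList-neg : ∀ (f : A → ℚ) xs → sumList (λ x → - f x) xs ≡ - sumList f xs
sumList-neg f []       = refl
sumList-neg f (x ∷ xs) =
  trans (cong (- f x +_) (sumList-neg f xs)) (sym (ℚ.neg-distrib-+ (f x) _))

sumList-- : ∀ (f g : A → ℚ) xs → sumList (λ x → f x - g x) xs ≡ sumList f xs - sumList g xs
sumList-- f g xs = trans (sumList-+ f (λ x → - g x) xs) (cong (sumList f xs +_) (sumList-neg g xs))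

sumList-++ : ∀ (f : A → ℚ) xs ys → sumList f (xs ++ ys) ≡ sumList f xs + sumList f ys
sumList-++ f []       ys = sym (ℚ.+-identityˡ _)
sumList-++ f (x ∷ xs) ys = trans (cong (f x +_) (sumList-++ f xs ys)) (sym (ℚ.+-assoc (f x) _ _))

sumList-map : ∀ (f : B → ℚ) (g : A → B) xs → sumList f (map g xs) ≡ sumList (f ∘ g) xs
sumList-map f g []       = refl
sumList-map f g (x ∷ xs) = cong (f (g x) +_) (sumList-map f g xs)

sumList-concatMap : ∀ (f : B → ℚ) (g : A → List B) xs →
                    sumList f (concatMap g xs) ≡ sumList (λ x → sumList f (g x)) xs
sumList-concatMap f g []       = refl
sumList-concatMap f g (x ∷ xs) =
  trans (sumList-++ f (g x) (concatMap g xs)) (cong (sumList f (g x) +_) (sumList-concatMap f g xs))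

sumList-cartesianProduct : ∀ (f : A × B → ℚ) xs ys →
  sumList f (cartesianProduct xs ys) ≡ sumList (λ x → sumList (λ y → f (x , y)) ys) xs
sumList-cartesianProduct f []       ys = refl
sumList-cartesianProduct f (x ∷ xs) ys =
  trans (sumList-++ f (map (x ,_) ys) (cartesianProduct xs ys))
        (cong₂ _+_ (sumList-map f (x ,_) ys) (sumList-cartesianProduct f xs ys))

sumList-comm : ∀ (f : A → B → ℚ) xs ys →
               sumList (λ x → sumList (f x) ys) xs ≡ sumList (λ y → sumList (λ x → f x y) xs) ys
sumList-comm f []       ys = sym (sumList-zero ys)
sumList-comm f (x ∷ xs) ys =
  trans (cong (sumList (f x) ys +_) (sumList-comm f xs ys))
        (sym (sumList-+ (f x) (λ y → sumList (λ x′ → f x′ y) xs) ys))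

module _ (_≟_ : DecidableEquality A) (f : A → ℚ) where

  sumList-pick-∉ : ∀ {u xs} → u ∉ xs → sumList (λ x → 𝟙 ⌊ u ≟ x ⌋ * f x) xs ≡ 0ℚ
  sumList-pick-∉ {u} {[]}     u∉xs = refl
  sumList-pick-∉ {u} {x ∷ xs} u∉xs with u ≟ x
  ... | yes u≡x = contradiction (here u≡x) u∉xs
  ... | no  _   = cong₂ _+_ (ℚ.*-zeroˡ (f x)) (sumList-pick-∉ (u∉xs ∘ there))

  sumList-pick : ∀ {u xs} → Unique xs → u ∈ xs → sumList (λ x → 𝟙 ⌊ u ≟ x ⌋ * f x) xs ≡ f u
  sumList-pick {u} {x ∷ xs} (x∉xs ∷ uxs) u∈x∷xs with u ≟ x | u∈x∷xs
  ... | yes refl | _          = trans (cong₂ _+_ (ℚ.*-identityˡ (f u)) (sumList-pick-∉ (All¬⇒¬Any x∉xs)))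
                                      (ℚ.+-identityʳ (f u))
  ... | no  u≢x  | here u≡x   = contradiction u≡x u≢x
  ... | no  _    | there u∈xs = trans (cong₂ _+_ (ℚ.*-zeroˡ (f x)) (sumList-pick uxs u∈xs)) (ℚ.+-identityˡ (f u))

-- Potentials in a resistor network

module Network (S : FinVertexSet) where
  open FinVertexSet S

  -- Holds when `all` lists every vertex exactly once (sumList-pick).
  Sifting : Set
  Sifting = ∀ u (f : V → ℚ) → Σᵥ (λ x → basis S u x * f x) ≡ f u

  Symmetric : Matrix V → Set
  Symmetric A = ∀ u w → A u w ≡ A w u

  infixr 7 _▸_
  _▸_ : Matrix V → (V → ℚ) → V → ℚ
  (A ▸ y) x = Σᵥ (λ z → A x z * y z)

  dot : (V → ℚ) → (V → ℚ) → ℚ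
  dot a b = Σᵥ (λ x → a x * b x)

  ▸-cong : ∀ {A B : Matrix V} {y z : V → ℚ} → _≈ₘ_ S A B → (∀ x → y x ≡ z x) → ∀ x → (A ▸ y) x ≡ (B ▸ z) x
  ▸-cong A≈B y≗z x = sumList-cong all (λ t → cong₂ _*_ (A≈B x t) (y≗z t))

  ▸-- : ∀ A (a b : V → ℚ) x → (A ▸ (λ z → a z - b z)) x ≡ (A ▸ a) x - (A ▸ b) x
  ▸-- A a b x =
    trans (sumList-cong all (λ z → ℚ.*-distribˡ-+ (A x z) (a z) (- b z)))
          (trans (sumList-+ (λ z → A x z * a z) (λ z → A x z * - b z) all)
                 (cong ((A ▸ a) x +_) (trans (sumList-cong all (λ z → sym (ℚ.neg-distribʳ-* (A x z) (b z))))
                                             (sumList-neg (λ z → A x z * b z) all))))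

  ▸-⊗ : ∀ M A (b : V → ℚ) x → (_⊗_ S M A ▸ b) x ≡ (M ▸ A ▸ b) x
  ▸-⊗ M A b x = begin
    Σᵥ (λ z → Σᵥ (λ t → M x t * A t z) * b z)
      ≡⟨ sumList-cong all (λ z → sym (sumList-*ʳ (b z) (λ t → M x t * A t z) all)) ⟩
    Σᵥ (λ z → Σᵥ (λ t → M x t * A t z * b z))
      ≡⟨ sumList-comm (λ z t → M x t * A t z * b z) all all ⟩
    Σᵥ (λ t → Σᵥ (λ z → M x t * A t z * b z))
      ≡⟨ sumList-cong all (λ t → trans (sumList-cong all (λ z → ℚ.*-assoc (M x t) (A t z) (b z)))
                                       (sumList-*ˡ (M x t) (λ z → A t z * b z) all)) ⟩
    Σᵥ (λ t → M x t * Σᵥ (λ z → A t z * b z))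
      ∎
    where open ≡-Reasoning

  dot-▸ : ∀ M (a b : V → ℚ) → Σᵥ (λ x → Σᵥ (λ t → a x * M x t * b t)) ≡ dot a (M ▸ b)
  dot-▸ M a b = sumList-cong all (λ x →
    trans (sumList-cong all (λ t → ℚ.*-assoc (a x) (M x t) (b t))) (sumList-*ˡ (a x) (λ t → M x t * b t) all))

  dot-▸-symmetric : ∀ {A} → Symmetric A → ∀ (a b : V → ℚ) → dot (A ▸ a) b ≡ dot a (A ▸ b)
  dot-▸-symmetric {A} A-sym a b = begin
    Σᵥ (λ x → Σᵥ (λ z → A x z * a z) * b x)
      ≡⟨ sumList-cong all (λ x → sym (sumList-*ʳ (b x) (λ z → A x z * a z) all)) ⟩
    Σᵥ (λ x → Σᵥ (λ z → A x z * a z * b x))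
      ≡⟨ sumList-comm (λ x z → A x z * a z * b x) all all ⟩
    Σᵥ (λ z → Σᵥ (λ x → A x z * a z * b x))
      ≡⟨ sumList-cong all (λ z → sumList-cong all (λ x → trans (cong (λ p → p * a z * b x) (A-sym x z))
                                                              (reorder (A z x) (a z) (b x)))) ⟩
    Σᵥ (λ z → Σᵥ (λ x → a z * (A z x * b x)))
      ≡⟨ sumList-cong all (λ z → sumList-*ˡ (a z) (λ x → A z x * b x) all) ⟩
    Σᵥ (λ z → a z * Σᵥ (λ x → A z x * b x))
      ∎
    where
    open ≡-Reasoning
    reorder : ∀ p s t → p * s * t ≡ s * (p * t)
    reorder = solve-∀ ℚ-ring

  dot-basis : Sifting → ∀ (y : V → ℚ) u w → dot y (λ x → basis S u x - basis S w x) ≡ y u - y w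
  dot-basis sift y u w = begin
    Σᵥ (λ x → y x * (basis S u x - basis S w x))
      ≡⟨ sumList-cong all (λ x → distrib (y x) (basis S u x) (basis S w x)) ⟩
    Σᵥ (λ x → basis S u x * y x - basis S w x * y x)
      ≡⟨ sumList-- (λ x → basis S u x * y x) (λ x → basis S w x * y x) all ⟩
    Σᵥ (λ x → basis S u x * y x) - Σᵥ (λ x → basis S w x * y x)
      ≡⟨ cong₂ _-_ (sift u y) (sift w y) ⟩
    y u - y w
      ∎
    where
    open ≡-Reasoning
    distrib : ∀ a p q → a * (p - q) ≡ p * a - q * a
    distrib = solve-∀ ℚ-ring

  resistanceDistance-potential :
    Sifting → ∀ {A X} → Symmetric A → _≈ₘ_ S (_⊗_ S (_⊗_ S A X) A) A →
    ∀ (y : V → ℚ) u w → (∀ x → (A ▸ y) x ≡ basis S u x - basis S w x) →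
    resistanceDistance S X u w ≡ y u - y w
  resistanceDistance-potential sift {A} {X} A-sym AXA≈A y u w Ay≡d = begin
    resistanceDistance S X u w        ≡⟨ dot-▸ X d d ⟩
    dot d (X ▸ d)                     ≡⟨ sumList-cong all (λ x → cong₂ _*_ (sym (Ay≡d x))
                                                                           (▸-cong {X} (λ _ _ → refl) (sym ∘ Ay≡d) x)) ⟩
    dot (A ▸ y) (X ▸ A ▸ y)           ≡⟨ dot-▸-symmetric A-sym y (X ▸ A ▸ y) ⟩
    dot y (A ▸ X ▸ A ▸ y)             ≡⟨ sumList-cong all (λ x → cong (y x *_) (AXAy≡Ay x)) ⟩
    dot y (A ▸ y)                     ≡⟨ sumList-cong all (λ x → cong (y x *_) (Ay≡d x)) ⟩
    dot y d                           ≡⟨ dot-basis sift y u w ⟩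
    y u - y w                         ∎
    where
    open ≡-Reasoning
    d : V → ℚ
    d x = basis S u x - basis S w x
    AXAy≡Ay : ∀ x → (A ▸ X ▸ A ▸ y) x ≡ (A ▸ y) x
    AXAy≡Ay x = begin
      (A ▸ X ▸ A ▸ y) x                   ≡⟨ sym (▸-⊗ A X (A ▸ y) x) ⟩
      (_⊗_ S A X ▸ A ▸ y) x               ≡⟨ sym (▸-⊗ (_⊗_ S A X) A y x) ⟩
      (_⊗_ S (_⊗_ S A X) A ▸ y) x         ≡⟨ ▸-cong AXA≈A (λ _ → refl) x ⟩
      (A ▸ y) x                           ∎

  pairSum : (V → V → ℚ) → List V → ℚ
  pairSum g xs = sumList (uncurry g) (unorderedPairs S xs)

  pairSum-double : ∀ (g : V → V → ℚ) → (∀ x → g x x ≡ 0ℚ) → (∀ x y → g x y ≡ g y x) →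
                   ∀ xs → pairSum g xs + pairSum g xs ≡ sumList (λ x → sumList (g x) xs) xs
  pairSum-double g g-diag g-sym []       = refl
  pairSum-double g g-diag g-sym (x ∷ xs) = begin
    pairSum g (x ∷ xs) + pairSum g (x ∷ xs)
      ≡⟨ cong (λ p → p + p) (trans (sumList-++ (uncurry g) (map (x ,_) xs) (unorderedPairs S xs))
                                   (cong (_+ P) (sumList-map (uncurry g) (x ,_) xs))) ⟩
    (R + P) + (R + P)                                ≡⟨ rearrange R P ⟩
    (0ℚ + R) + (R + (P + P))
      ≡⟨ cong₂ (λ d c → (d + R) + (c + (P + P))) (sym (g-diag x)) (sumList-cong xs (g-sym x)) ⟩
    (g x x + R) + (sumList (λ u → g u x) xs + (P + P))
      ≡⟨ cong (λ q → (g x x + R) + (sumList (λ u → g u x) xs + q)) (pairSum-double g g-diag g-sym xs) ⟩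
    (g x x + R) + (sumList (λ u → g u x) xs + sumList (λ u → sumList (g u) xs) xs)
      ≡⟨ cong ((g x x + R) +_) (sym (sumList-+ (λ u → g u x) (λ u → sumList (g u) xs) xs)) ⟩
    sumList (λ u → sumList (g u) (x ∷ xs)) (x ∷ xs)  ∎
    where
    open ≡-Reasoning
    R P : ℚ
    R = sumList (g x) xs
    P = pairSum g xs
    rearrange : ∀ r p → (r + p) + (r + p) ≡ (0ℚ + r) + (r + (p + p))
    rearrange = solve-∀ ℚ-ring

  #V : ℚ
  #V = Σᵥ (λ _ → 1ℚ)

  Σᵥ-const : ∀ c → Σᵥ (λ _ → c) ≡ c * #V
  Σᵥ-const c = trans (sumList-cong all (λ _ → sym (ℚ.*-identityʳ c))) (sumList-*ˡ c (λ _ → 1ℚ) all)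

  Σᵥ-Σᵥ-resistance : ∀ (H : V → V → ℚ) →
    Σᵥ (λ u → Σᵥ (λ w → (H u u - H w u) - (H u w - H w w)))
      ≡ (Σᵥ (λ u → H u u) * #V + Σᵥ (λ u → H u u) * #V) - (Σᵥ (λ u → Σᵥ (H u)) + Σᵥ (λ u → Σᵥ (H u)))
  Σᵥ-Σᵥ-resistance H = begin
    Σᵥ (λ u → Σᵥ (λ w → (H u u - H w u) - (H u w - H w w)))
      ≡⟨ sumList-cong all row ⟩
    Σᵥ (λ u → (H u u * #V + D) - (Σᵥ (λ w → H w u) + Σᵥ (H u)))
      ≡⟨ sumList-- (λ u → H u u * #V + D) (λ u → Σᵥ (λ w → H w u) + Σᵥ (H u)) all ⟩
    Σᵥ (λ u → H u u * #V + D) - Σᵥ (λ u → Σᵥ (λ w → H w u) + Σᵥ (H u))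
      ≡⟨ cong₂ _-_ (trans (sumList-+ (λ u → H u u * #V) (λ _ → D) all)
                          (cong₂ _+_ (sumList-*ʳ #V (λ u → H u u) all) (Σᵥ-const D)))
                   (trans (sumList-+ (λ u → Σᵥ (λ w → H w u)) (λ u → Σᵥ (H u)) all)
                          (cong (_+ T) (sumList-comm (λ u w → H w u) all all))) ⟩
    (D * #V + D * #V) - (T + T)
      ∎
    where
    open ≡-Reasoning
    D T : ℚ
    D = Σᵥ (λ u → H u u)
    T = Σᵥ (λ u → Σᵥ (H u))
    split : ∀ uu wu uw ww → (uu - wu) - (uw - ww) ≡ (uu * 1ℚ + ww) - (wu + uw)
    split = solve-∀ ℚ-ring
    row : ∀ u → Σᵥ (λ w → (H u u - H w u) - (H u w - H w w)) ≡ (H u u * #V + D) - (Σᵥ (λ w → H w u) + Σᵥ (H u))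
    row u = begin
      Σᵥ (λ w → (H u u - H w u) - (H u w - H w w))
        ≡⟨ sumList-cong all (λ w → split (H u u) (H w u) (H u w) (H w w)) ⟩
      Σᵥ (λ w → (H u u * 1ℚ + H w w) - (H w u + H u w))
        ≡⟨ sumList-- (λ w → H u u * 1ℚ + H w w) (λ w → H w u + H u w) all ⟩
      Σᵥ (λ w → H u u * 1ℚ + H w w) - Σᵥ (λ w → H w u + H u w)
        ≡⟨ cong₂ _-_ (trans (sumList-+ (λ _ → H u u * 1ℚ) (λ w → H w w) all) (cong (_+ D) (sumList-*ˡ (H u u) (λ _ → 1ℚ) all)))
                     (sumList-+ (λ w → H w u) (H u) all) ⟩
      (H u u * #V + D) - (Σᵥ (λ w → H w u) + Σᵥ (H u))
        ∎

  module _ (sift : Sifting) {A X : Matrix V} (A-sym : Symmetric A) (AXA≈A : _≈ₘ_ S (_⊗_ S (_⊗_ S A X) A) A)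
           (H : V → V → ℚ) (r : V) (AH≡e : ∀ u x → (A ▸ H u) x ≡ basis S u x - basis S r x) where

    resistanceDistance-grounded : ∀ u w → resistanceDistance S X u w ≡ (H u u - H w u) - (H u w - H w w)
    resistanceDistance-grounded u w =
      resistanceDistance-potential sift A-sym AXA≈A (λ x → H u x - H w x) u w (λ x →
        trans (▸-- A (H u) (H w) x)
              (trans (cong₂ _-_ (AH≡e u x) (AH≡e w x)) (cancel (basis S u x) (basis S w x) (basis S r x))))
      where
      cancel : ∀ a b c → (a - c) - (b - c) ≡ a - b
      cancel = solve-∀ ℚ-ring

    kirchhoffIndex-grounded : kirchhoffIndex S X ≡ #V * Σᵥ (λ u → H u u) - Σᵥ (λ u → Σᵥ (H u))
    kirchhoffIndex-grounded = begin
      kirchhoffIndex S X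
        ≡⟨ sumList-cong (unorderedPairs S all) (λ { (u , w) → resistanceDistance-grounded u w }) ⟩
      pairSum ω all
        ≡⟨ half-double (pairSum ω all) ⟩
      ½ * (pairSum ω all + pairSum ω all)
        ≡⟨ cong (½ *_) (pairSum-double ω (λ u → ω-diag (H u u)) (λ u w → ω-sym (H u u) (H w u) (H u w) (H w w)) all) ⟩
      ½ * Σᵥ (λ u → Σᵥ (ω u))
        ≡⟨ cong (½ *_) (Σᵥ-Σᵥ-resistance H) ⟩
      ½ * ((D * #V + D * #V) - (T + T))
        ≡⟨ collect D #V T ⟩
      #V * D - T
        ∎
      where
      open ≡-Reasoning
      D T : ℚ
      D = Σᵥ (λ u → H u u)
      T = Σᵥ (λ u → Σᵥ (H u))
      ω : V → V → ℚ
      ω u w = (H u u - H w u) - (H u w - H w w)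
      ω-diag : ∀ a → (a - a) - (a - a) ≡ 0ℚ
      ω-diag = solve-∀ ℚ-ring
      ω-sym : ∀ uu wu uw ww → (uu - wu) - (uw - ww) ≡ (ww - uw) - (wu - uu)
      ω-sym = solve-∀ ℚ-ring
      half-double : ∀ x → x ≡ ½ * (x + x)
      half-double = solve-∀ ℚ-ring
      collect : ∀ d n t → ½ * ((d * n + d * n) - (t + t)) ≡ n * d - t
      collect = solve-∀ ℚ-ring

  Loopless : Edge V → Set
  Loopless e = ¬ Edge.end₁ e ≡ Edge.end₂ e

  flow : Edge V → (V → ℚ) → V → ℚ
  flow e y x = 𝟙 (Edge.end₁ e == x) * (conductance e * (y (Edge.end₁ e) - y (Edge.end₂ e)))
             + 𝟙 (Edge.end₂ e == x) * (conductance e * (y (Edge.end₂ e) - y (Edge.end₁ e)))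

  adjacency : Edge V → Matrix V
  adjacency e x z = if ((Edge.end₁ e == x) ∧ (Edge.end₂ e == z)) ∨ ((Edge.end₁ e == z) ∧ (Edge.end₂ e == x))
                    then conductance e else 0ℚ

  adjacency-symmetric : ∀ e → Symmetric (adjacency e)
  adjacency-symmetric e x z =
    cong (λ b → if b then conductance e else 0ℚ)
         (∨-comm ((Edge.end₁ e == x) ∧ (Edge.end₂ e == z)) ((Edge.end₁ e == z) ∧ (Edge.end₂ e == x)))

  laplacian-symmetric : ∀ es → Symmetric (laplacian S es)
  laplacian-symmetric es u w with u ≟ w | w ≟ u
  ... | yes refl | yes _   = refl
  ... | yes u≡w  | no w≢u  = contradiction (sym u≡w) w≢u
  ... | no u≢w   | yes w≡u = contradiction (sym w≡u) u≢w
  ... | no _     | no _    = cong -_ (sumList-cong es (λ e → adjacency-symmetric e u w))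

  private
    c≡c*[1-0] : ∀ c → c ≡ c * (1ℚ - 0ℚ)
    c≡c*[1-0] = solve-∀ ℚ-ring
    -c≡c*[0-1] : ∀ c → - c ≡ c * (0ℚ - 1ℚ)
    -c≡c*[0-1] = solve-∀ ℚ-ring
    first-term : ∀ t s → t ≡ 1ℚ * t + 0ℚ * s
    first-term = solve-∀ ℚ-ring
    second-term : ∀ t s → t ≡ 0ℚ * s + 1ℚ * t
    second-term = solve-∀ ℚ-ring
    neither-term : ∀ s t → 0ℚ ≡ 0ℚ * s + 0ℚ * t
    neither-term = solve-∀ ℚ-ring

  -- Opaque, so that case splits on the endpoints in edgeLaplacian-▸ do not rewrite inside it.
  opaque
    edgeLaplacian : Edge V → Matrix V
    edgeLaplacian e x z =
      if x == z then (if (Edge.end₁ e == x) ∨ (Edge.end₂ e == x) then conductance e else 0ℚ)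
      else - adjacency e x z

  opaque
    unfolding edgeLaplacian

    laplacian≡sumList-edgeLaplacian : ∀ es x z → laplacian S es x z ≡ sumList (λ e → edgeLaplacian e x z) es
    laplacian≡sumList-edgeLaplacian es x z with x ≟ z
    ... | yes _ = refl
    ... | no  _ = sym (sumList-neg (λ e → adjacency e x z) es)

    edgeLaplacian-end₁ : ∀ e → Loopless e → ∀ z →
      edgeLaplacian e (Edge.end₁ e) z ≡ conductance e * (basis S (Edge.end₁ e) z - basis S (Edge.end₂ e) z)
    edgeLaplacian-end₁ (edge a b r) a≢b z with a ≟ a | b ≟ a | a ≟ z | b ≟ z
    ... | no a≢a | _       | _        | _        = contradiction refl a≢a
    ... | _      | yes b≡a | _        | _        = contradiction (sym b≡a) a≢b
    ... | yes _  | no _    | yes refl | yes refl = contradiction refl a≢b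
    ... | yes _  | no _    | yes refl | no _     = c≡c*[1-0] (conductance (edge a b r))
    ... | yes _  | no _    | no _     | yes refl = -c≡c*[0-1] (conductance (edge a b r))
    ... | yes _  | no _    | no _     | no _     = sym (ℚ.*-zeroʳ (conductance (edge a b r)))

    edgeLaplacian-end₂ : ∀ e → Loopless e → ∀ z →
      edgeLaplacian e (Edge.end₂ e) z ≡ conductance e * (basis S (Edge.end₂ e) z - basis S (Edge.end₁ e) z)
    edgeLaplacian-end₂ (edge a b r) a≢b z with b ≟ b | a ≟ b | b ≟ z | a ≟ z
    ... | no b≢b | _       | _        | _        = contradiction refl b≢b
    ... | _      | yes a≡b | _        | _        = contradiction a≡b a≢b
    ... | yes _  | no _    | yes refl | yes refl = contradiction refl a≢b
    ... | yes _  | no _    | yes refl | no _     = c≡c*[1-0] (conductance (edge a b r))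
    ... | yes _  | no _    | no _     | yes refl = -c≡c*[0-1] (conductance (edge a b r))
    ... | yes _  | no _    | no _     | no _     = sym (ℚ.*-zeroʳ (conductance (edge a b r)))

    edgeLaplacian-other : ∀ e x → ¬ Edge.end₁ e ≡ x → ¬ Edge.end₂ e ≡ x → ∀ z → edgeLaplacian e x z ≡ 0ℚ
    edgeLaplacian-other (edge a b r) x a≢x b≢x z with a ≟ x | b ≟ x | x ≟ z | a ≟ z
    ... | yes a≡x | _       | _     | _     = contradiction a≡x a≢x
    ... | _       | yes b≡x | _     | _     = contradiction b≡x b≢x
    ... | no _    | no _    | yes _ | _     = refl
    ... | no _    | no _    | no _  | yes _ = refl
    ... | no _    | no _    | no _  | no _  = refl

  ▸-difference : Sifting → ∀ c p q (y : V → ℚ) →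
                 Σᵥ (λ z → c * (basis S p z - basis S q z) * y z) ≡ c * (y p - y q)
  ▸-difference sift c p q y =
    trans (sumList-cong all (λ z → reorder c (basis S p z - basis S q z) (y z)))
          (trans (sumList-*ˡ c (λ z → y z * (basis S p z - basis S q z)) all) (cong (c *_) (dot-basis sift y p q)))
    where
    reorder : ∀ c d t → c * d * t ≡ c * (t * d)
    reorder = solve-∀ ℚ-ring

  edgeLaplacian-▸ : Sifting → ∀ e → Loopless e → ∀ y x → Σᵥ (λ z → edgeLaplacian e x z * y z) ≡ flow e y x
  edgeLaplacian-▸ sift e@(edge a b r) a≢b y x with a ≟ x | b ≟ x
  ... | yes refl | yes refl = contradiction refl a≢b
  ... | yes refl | no _     =
    trans (sumList-cong all (λ z → cong (_* y z) (edgeLaplacian-end₁ e a≢b z)))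
          (trans (▸-difference sift (conductance e) a b y) (first-term _ (conductance e * (y b - y a))))
  ... | no _     | yes refl =
    trans (sumList-cong all (λ z → cong (_* y z) (edgeLaplacian-end₂ e a≢b z)))
          (trans (▸-difference sift (conductance e) b a y) (second-term _ (conductance e * (y a - y b))))
  ... | no a≢x   | no b≢x   =
    trans (sumList-cong all (λ z → trans (cong (_* y z) (edgeLaplacian-other e x a≢x b≢x z)) (ℚ.*-zeroˡ (y z))))
          (trans (sumList-zero all) (neither-term (conductance e * (y a - y b)) (conductance e * (y b - y a))))

  laplacian-▸ : Sifting → ∀ {es} → All Loopless es → ∀ y x → (laplacian S es ▸ y) x ≡ sumList (λ e → flow e y x) es
  laplacian-▸ sift {es} loopless y x = begin
    Σᵥ (λ z → laplacian S es x z * y z)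
      ≡⟨ sumList-cong all (λ z → trans (cong (_* y z) (laplacian≡sumList-edgeLaplacian es x z))
                                       (sym (sumList-*ʳ (y z) (λ e → edgeLaplacian e x z) es))) ⟩
    Σᵥ (λ z → sumList (λ e → edgeLaplacian e x z * y z) es)
      ≡⟨ sumList-comm (λ z e → edgeLaplacian e x z * y z) all es ⟩
    sumList (λ e → Σᵥ (λ z → edgeLaplacian e x z * y z)) es
      ≡⟨ edges loopless ⟩
    sumList (λ e → flow e y x) es
      ∎
    where
    open ≡-Reasoning
    edges : ∀ {es} → All Loopless es →
            sumList (λ e → Σᵥ (λ z → edgeLaplacian e x z * y z)) es ≡ sumList (λ e → flow e y x) es
    edges []       = refl
    edges (l ∷ ls) = cong₂ _+_ (edgeLaplacian-▸ sift _ l y x) (edges ls)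

sumBelow : ℕ → (ℕ → ℚ) → ℚ
sumBelow zero    f = 0ℚ
sumBelow (suc n) f = f 0 + sumBelow n (f ∘ suc)

sumList-allFin : ∀ n (F : ℕ → ℚ) → sumList (F ∘ toℕ) (allFin n) ≡ sumBelow n F
sumList-allFin zero    F = refl
sumList-allFin (suc n) F = cong (F 0 +_) (begin
  sumList (F ∘ toℕ) (tabulate {n = n} suc)    ≡⟨ cong (sumList (F ∘ toℕ)) (sym (map-tabulate {n = n} id suc)) ⟩
  sumList (F ∘ toℕ) (map suc (allFin n))      ≡⟨ sumList-map (F ∘ toℕ) suc (allFin n) ⟩
  sumList (F ∘ suc ∘ toℕ) (allFin n)          ≡⟨ sumList-allFin n (F ∘ suc) ⟩
  sumBelow n (F ∘ suc)                        ∎)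
  where open ≡-Reasoning

sumBelow-cong : ∀ n {f g : ℕ → ℚ} → (∀ k → k ℕ.< n → f k ≡ g k) → sumBelow n f ≡ sumBelow n g
sumBelow-cong zero    f≗g = refl
sumBelow-cong (suc n) f≗g = cong₂ _+_ (f≗g 0 ℕ.z<s) (sumBelow-cong n (λ k k<n → f≗g (suc k) (ℕ.s<s k<n)))

sumBelow-+ : ∀ n (f g : ℕ → ℚ) → sumBelow n (λ k → f k + g k) ≡ sumBelow n f + sumBelow n g
sumBelow-+ zero    f g = refl
sumBelow-+ (suc n) f g = trans (cong (f 0 + g 0 +_) (sumBelow-+ n (f ∘ suc) (g ∘ suc))) (+-interchange (f 0) (g 0) _ _)

sumBelow-*ˡ : ∀ n c (f : ℕ → ℚ) → sumBelow n (λ k → c * f k) ≡ c * sumBelow n f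
sumBelow-*ˡ zero    c f = sym (ℚ.*-zeroʳ c)
sumBelow-*ˡ (suc n) c f = trans (cong (c * f 0 +_) (sumBelow-*ˡ n c (f ∘ suc))) (sym (ℚ.*-distribˡ-+ c (f 0) _))

sumBelow-snoc : ∀ n (f : ℕ → ℚ) → sumBelow (suc n) f ≡ sumBelow n f + f n
sumBelow-snoc zero    f = ℚ.+-comm (f 0) 0ℚ
sumBelow-snoc (suc n) f = trans (cong (f 0 +_) (sumBelow-snoc n (f ∘ suc))) (sym (ℚ.+-assoc (f 0) _ _))

≡ᵇ-refl : ∀ n → (n ≡ᵇ n) ≡ true
≡ᵇ-refl zero    = refl
≡ᵇ-refl (suc n) = ≡ᵇ-refl n

≡ᵇ-false : ∀ {m k} → k ℕ.< m → (m ≡ᵇ k) ≡ false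
≡ᵇ-false {suc m} {zero}  _           = refl
≡ᵇ-false {suc m} {suc k} (ℕ.s≤s k<m) = ≡ᵇ-false k<m

𝟙≡ᵇ-subst : ∀ j k (F : ℕ → ℚ) → 𝟙 (j ≡ᵇ k) * F j ≡ 𝟙 (j ≡ᵇ k) * F k
𝟙≡ᵇ-subst zero    zero    F = refl
𝟙≡ᵇ-subst zero    (suc k) F = trans (ℚ.*-zeroˡ (F 0)) (sym (ℚ.*-zeroˡ (F (suc k))))
𝟙≡ᵇ-subst (suc j) zero    F = trans (ℚ.*-zeroˡ (F (suc j))) (sym (ℚ.*-zeroˡ (F 0)))
𝟙≡ᵇ-subst (suc j) (suc k) F = 𝟙≡ᵇ-subst j k (F ∘ suc)

sumBelow-select : ∀ n K (F : ℕ → ℚ) → sumBelow n (λ k → 𝟙 (k ≡ᵇ K) * F k) ≡ 𝟙 (K <ᵇ n) * F K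
sumBelow-select zero    K       F = sym (ℚ.*-zeroˡ (F K))
sumBelow-select (suc n) zero    F = trans (cong (1ℚ * F 0 +_) (sumBelow-zero n)) (ℚ.+-identityʳ _)
  where
  sumBelow-zero : ∀ n → sumBelow n (λ k → 0ℚ * F (suc k)) ≡ 0ℚ
  sumBelow-zero n = trans (sumBelow-*ˡ n 0ℚ (F ∘ suc)) (ℚ.*-zeroˡ (sumBelow n (F ∘ suc)))
sumBelow-select (suc n) (suc K) F =
  trans (cong₂ _+_ (ℚ.*-zeroˡ (F 0)) (sumBelow-select n K (F ∘ suc))) (ℚ.+-identityˡ _)

sumBelow-select-suc : ∀ n K (F : ℕ → ℚ) → K ℕ.≤ n →
                      sumBelow n (λ k → 𝟙 (suc k ≡ᵇ K) * F (suc k)) ≡ 𝟙 (0 <ᵇ K) * F K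
sumBelow-select-suc n zero    F _   =
  trans (sumBelow-*ˡ n 0ℚ (F ∘ suc)) (trans (ℚ.*-zeroˡ (sumBelow n (F ∘ suc))) (sym (ℚ.*-zeroˡ (F 0))))
sumBelow-select-suc n (suc K) F K<n =
  trans (sumBelow-select n K (F ∘ suc)) (cong (λ b → 𝟙 b * F (suc K)) (Equivalence.to T-≡ (<⇒<ᵇ K<n)))

toℚ : ℕ → ℚ
toℚ zero    = 0ℚ
toℚ (suc n) = 1ℚ + toℚ n

toℚ-+ : ∀ a b → toℚ (a ℕ.+ b) ≡ toℚ a + toℚ b
toℚ-+ zero    b = sym (ℚ.+-identityˡ (toℚ b))
toℚ-+ (suc a) b = trans (cong (1ℚ +_) (toℚ-+ a b)) (sym (ℚ.+-assoc 1ℚ (toℚ a) (toℚ b)))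

toℚ-* : ∀ a b → toℚ (a ℕ.* b) ≡ toℚ a * toℚ b
toℚ-* zero    b = sym (ℚ.*-zeroˡ (toℚ b))
toℚ-* (suc a) b = trans (toℚ-+ b (a ℕ.* b)) (trans (cong (toℚ b +_) (toℚ-* a b)) (distrib (toℚ a) (toℚ b)))
  where
  distrib : ∀ x y → y + x * y ≡ (1ℚ + x) * y
  distrib = solve-∀ ℚ-ring

sumBelow-const : ∀ n c → sumBelow n (λ _ → c) ≡ toℚ n * c
sumBelow-const zero    c = sym (ℚ.*-zeroˡ c)
sumBelow-const (suc n) c = trans (cong (c +_) (sumBelow-const n c)) (distrib (toℚ n) c)
  where
  distrib : ∀ x c → c + x * c ≡ (1ℚ + x) * c
  distrib = solve-∀ ℚ-ring

sumBelow-toℚ : ∀ n → toℚ 2 * sumBelow n toℚ ≡ toℚ n * (toℚ n - 1ℚ)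
sumBelow-toℚ zero    = refl
sumBelow-toℚ (suc n) = begin
  toℚ 2 * sumBelow (suc n) toℚ              ≡⟨ cong (toℚ 2 *_) (sumBelow-snoc n toℚ) ⟩
  toℚ 2 * (sumBelow n toℚ + toℚ n)          ≡⟨ ℚ.*-distribˡ-+ (toℚ 2) (sumBelow n toℚ) (toℚ n) ⟩
  toℚ 2 * sumBelow n toℚ + toℚ 2 * toℚ n    ≡⟨ cong (_+ toℚ 2 * toℚ n) (sumBelow-toℚ n) ⟩
  toℚ n * (toℚ n - 1ℚ) + toℚ 2 * toℚ n      ≡⟨ step (toℚ n) ⟩
  toℚ (suc n) * (toℚ (suc n) - 1ℚ)          ∎
  where
  open ≡-Reasoning
  step : ∀ t → t * (t - 1ℚ) + toℚ 2 * t ≡ (1ℚ + t) * ((1ℚ + t) - 1ℚ)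
  step = solve-∀ ℚ-ring

sumBelow-⊓ : ∀ n → toℚ 6 * sumBelow n (λ I → sumBelow n (λ K → toℚ (K ⊓ I)))
                   ≡ (toℚ n - 1ℚ) * toℚ n * (toℚ 2 * toℚ n - 1ℚ)
sumBelow-⊓ zero    = refl
sumBelow-⊓ (suc n) = begin
  toℚ 6 * G (suc n)                                           ≡⟨ cong (toℚ 6 *_) G-suc ⟩
  toℚ 6 * (G n + S + (S + toℚ n))                             ≡⟨ expand (G n) S (toℚ n) ⟩
  toℚ 6 * G n + toℚ 6 * (toℚ 2 * S) + toℚ 6 * toℚ n
                                              ≡⟨ cong₂ (λ a b → a + toℚ 6 * b + toℚ 6 * toℚ n) (sumBelow-⊓ n) (sumBelow-toℚ n) ⟩
  (toℚ n - 1ℚ) * toℚ n * (toℚ 2 * toℚ n - 1ℚ) + toℚ 6 * (toℚ n * (toℚ n - 1ℚ)) + toℚ 6 * toℚ n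
                                                              ≡⟨ step (toℚ n) ⟩
  (toℚ (suc n) - 1ℚ) * toℚ (suc n) * (toℚ 2 * toℚ (suc n) - 1ℚ) ∎
  where
  open ≡-Reasoning
  G : ℕ → ℚ
  G k = sumBelow k (λ I → sumBelow k (λ K → toℚ (K ⊓ I)))
  S : ℚ
  S = sumBelow n toℚ
  G-suc : G (suc n) ≡ G n + S + (S + toℚ n)
  G-suc = begin
    sumBelow (suc n) (λ I → sumBelow (suc n) (λ K → toℚ (K ⊓ I)))
      ≡⟨ sumBelow-cong (suc n) (λ I _ → sumBelow-snoc n (λ K → toℚ (K ⊓ I))) ⟩
    sumBelow (suc n) (λ I → sumBelow n (λ K → toℚ (K ⊓ I)) + toℚ (n ⊓ I))
      ≡⟨ sumBelow-snoc n (λ I → sumBelow n (λ K → toℚ (K ⊓ I)) + toℚ (n ⊓ I)) ⟩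
    sumBelow n (λ I → sumBelow n (λ K → toℚ (K ⊓ I)) + toℚ (n ⊓ I)) + (sumBelow n (λ K → toℚ (K ⊓ n)) + toℚ (n ⊓ n))
      ≡⟨ cong₂ _+_ (trans (sumBelow-+ n (λ I → sumBelow n (λ K → toℚ (K ⊓ I))) (λ I → toℚ (n ⊓ I)))
                          (cong (G n +_) (sumBelow-cong n (λ I I<n → cong toℚ (m≥n⇒m⊓n≡n (<⇒≤ I<n))))))
                   (cong₂ _+_ (sumBelow-cong n (λ K K<n → cong toℚ (m≤n⇒m⊓n≡m (<⇒≤ K<n)))) (cong toℚ (⊓-idem n))) ⟩
    G n + S + (S + toℚ n)
      ∎
  expand : ∀ g s t → toℚ 6 * (g + s + (s + t)) ≡ toℚ 6 * g + toℚ 6 * (toℚ 2 * s) + toℚ 6 * t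
  expand = solve-∀ ℚ-ring
  step : ∀ t → (t - 1ℚ) * t * (toℚ 2 * t - 1ℚ) + toℚ 6 * (t * (t - 1ℚ)) + toℚ 6 * t
               ≡ ((1ℚ + t) - 1ℚ) * (1ℚ + t) * (toℚ 2 * (1ℚ + t) - 1ℚ)
  step = solve-∀ ℚ-ring

-- The path of layers

¼ : ℚ
¼ = ℤ.+ 1 / 4

pathLaplacian : ℕ → (ℕ → ℚ) → ℕ → ℚ
pathLaplacian m f K = 𝟙 (K <ᵇ m) * (f K - f (suc K)) + 𝟙 (0 <ᵇ K) * (f K - f (ℕ.pred K))

pathLaplacian-*ˡ : ∀ m c f K → pathLaplacian m (λ k → c * f k) K ≡ c * pathLaplacian m f K
pathLaplacian-*ˡ m c f K = factor (𝟙 (K <ᵇ m)) (𝟙 (0 <ᵇ K)) c (f K) (f (suc K)) (f (ℕ.pred K))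
  where
  factor : ∀ p q c x y z → p * (c * x - c * y) + q * (c * x - c * z) ≡ c * (p * (x - y) + q * (x - z))
  factor = solve-∀ ℚ-ring

toℚ-suc-⊓ : ∀ K I → toℚ (suc K ⊓ I) ≡ toℚ (K ⊓ I) + 𝟙 (K <ᵇ I)
toℚ-suc-⊓ zero    zero    = refl
toℚ-suc-⊓ zero    (suc I) = refl
toℚ-suc-⊓ (suc K) zero    = refl
toℚ-suc-⊓ (suc K) (suc I) = trans (cong (1ℚ +_) (toℚ-suc-⊓ K I)) (sym (ℚ.+-assoc 1ℚ (toℚ (K ⊓ I)) _))

private
  step-indicator : ∀ J I m → I ℕ.≤ m → 𝟙 (J <ᵇ I) - 𝟙 (suc J <ᵇ m) * 𝟙 (suc J <ᵇ I) ≡ 𝟙 (I ≡ᵇ suc J)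
  step-indicator J       zero          m       _         = cong (_-_ 0ℚ) (ℚ.*-zeroʳ (𝟙 (suc J <ᵇ m)))
  step-indicator zero    (suc zero)    m       _         = cong (_-_ 1ℚ) (ℚ.*-zeroʳ (𝟙 (1 <ᵇ m)))
  step-indicator zero    (suc (suc I)) (suc (suc m)) _   = refl
  step-indicator zero    (suc (suc I)) (suc zero) (ℕ.s≤s ())
  step-indicator (suc J) (suc I)       (suc m) (ℕ.s≤s I≤m) = step-indicator J I m I≤m

pathLaplacian-⊓ : ∀ {m I} → I ℕ.≤ m → ∀ K → pathLaplacian m (λ k → toℚ (k ⊓ I)) K ≡ 𝟙 (I ≡ᵇ K) - 𝟙 (0 ≡ᵇ K)
pathLaplacian-⊓ {zero}  {zero}  _ zero    = refl
pathLaplacian-⊓ {suc m} {zero}  _ zero    = refl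
pathLaplacian-⊓ {suc m} {suc I} _ zero    = refl
pathLaplacian-⊓ {m}     {I}     I≤m (suc J) = begin
  𝟙 (suc J <ᵇ m) * (F (suc J) - F (suc (suc J))) + 1ℚ * (F (suc J) - F J)
    ≡⟨ cong₂ (λ p q → 𝟙 (suc J <ᵇ m) * (F (suc J) - p) + 1ℚ * (q - F J)) (toℚ-suc-⊓ (suc J) I) (toℚ-suc-⊓ J I) ⟩
  𝟙 (suc J <ᵇ m) * (F (suc J) - (F (suc J) + 𝟙 (suc J <ᵇ I))) + 1ℚ * ((F J + 𝟙 (J <ᵇ I)) - F J)
    ≡⟨ telescope (𝟙 (suc J <ᵇ m)) (F (suc J)) (𝟙 (suc J <ᵇ I)) (F J) (𝟙 (J <ᵇ I)) ⟩
  𝟙 (J <ᵇ I) - 𝟙 (suc J <ᵇ m) * 𝟙 (suc J <ᵇ I)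
    ≡⟨ step-indicator J I m I≤m ⟩
  𝟙 (I ≡ᵇ suc J)
    ≡⟨ sym (ℚ.+-identityʳ _) ⟩
  𝟙 (I ≡ᵇ suc J) - 0ℚ
    ∎
  where
  open ≡-Reasoning
  F : ℕ → ℚ
  F k = toℚ (k ⊓ I)
  telescope : ∀ x a p b q → x * (a - (a + p)) + 1ℚ * ((b + q) - b) ≡ q - x * p
  telescope = solve-∀ ℚ-ring

-- The ladder Laplacian scales odd vectors σ s * g K by twist m K (laplacian-layered): two edges go
-- to each neighbouring layer, and each of the two rungs of the last layer counts twice.
twist : ℕ → ℕ → ℚ
twist m K = toℚ 2 * 𝟙 (K <ᵇ m) + toℚ 2 * 𝟙 (0 <ᵇ K) + toℚ 4 * 𝟙 (m ≡ᵇ K)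

amplitude : ℕ → ℕ → ℚ
amplitude zero    zero    = ℤ.+ 1 / 8
amplitude (suc m) zero    = ¼
amplitude m       (suc K) = if m ≡ᵇ suc K then ℤ.+ 1 / 12 else ℤ.+ 1 / 8

twist*amplitude : ∀ m K → K ℕ.≤ m → twist m K * amplitude m K ≡ ½
twist*amplitude zero          zero          _           = refl
twist*amplitude (suc m)       zero          _           = refl
twist*amplitude (suc zero)    (suc zero)    _           = refl
twist*amplitude (suc (suc m)) (suc zero)    _           = refl
twist*amplitude (suc (suc m)) (suc (suc K)) (ℕ.s≤s K≤m) = twist*amplitude (suc m) (suc K) K≤m
twist*amplitude (suc zero)    (suc (suc K)) (ℕ.s≤s ())

twist-odd : ∀ m I K c → K ℕ.≤ m →
  twist m K * (𝟙 (I ≡ᵇ K) * (c * amplitude m I) - 𝟙 (0 ≡ᵇ K) * amplitude m 0) ≡ 𝟙 (I ≡ᵇ K) * (c * ½) - 𝟙 (0 ≡ᵇ K) * ½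
twist-odd m I K c K≤m = begin
  t * (𝟙 (I ≡ᵇ K) * (c * amplitude m I) - 𝟙 (0 ≡ᵇ K) * amplitude m 0)
    ≡⟨ distribute t (𝟙 (I ≡ᵇ K)) c (amplitude m I) (𝟙 (0 ≡ᵇ K)) (amplitude m 0) ⟩
  𝟙 (I ≡ᵇ K) * (c * (t * amplitude m I)) - 𝟙 (0 ≡ᵇ K) * (t * amplitude m 0)
    ≡⟨ cong₂ _-_ (𝟙≡ᵇ-subst I K (λ j → c * (t * amplitude m j))) (𝟙≡ᵇ-subst 0 K (λ j → t * amplitude m j)) ⟩
  𝟙 (I ≡ᵇ K) * (c * (t * amplitude m K)) - 𝟙 (0 ≡ᵇ K) * (t * amplitude m K)
    ≡⟨ cong (λ h → 𝟙 (I ≡ᵇ K) * (c * h) - 𝟙 (0 ≡ᵇ K) * h) (twist*amplitude m K K≤m) ⟩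
  𝟙 (I ≡ᵇ K) * (c * ½) - 𝟙 (0 ≡ᵇ K) * ½
    ∎
  where
  open ≡-Reasoning
  t : ℚ
  t = twist m K
  distribute : ∀ t p c A q B → t * (p * (c * A) - q * B) ≡ p * (c * (t * A)) - q * (t * B)
  distribute = solve-∀ ℚ-ring

sumBelow-amplitude : ∀ m → sumBelow (suc (suc m)) (amplitude (suc m)) ≡ ¼ + (toℚ m * (ℤ.+ 1 / 8) + ℤ.+ 1 / 12)
sumBelow-amplitude m = cong (¼ +_) (begin
  sumBelow (suc m) (λ k → if m ≡ᵇ k then ℤ.+ 1 / 12 else ℤ.+ 1 / 8)
    ≡⟨ sumBelow-snoc m (λ k → if m ≡ᵇ k then ℤ.+ 1 / 12 else ℤ.+ 1 / 8) ⟩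
  sumBelow m (λ k → if m ≡ᵇ k then ℤ.+ 1 / 12 else ℤ.+ 1 / 8) + (if m ≡ᵇ m then ℤ.+ 1 / 12 else ℤ.+ 1 / 8)
    ≡⟨ cong₂ _+_ (sumBelow-cong m (λ k k<m → cong (λ b → if b then ℤ.+ 1 / 12 else ℤ.+ 1 / 8) (≡ᵇ-false k<m)))
                 (cong (λ b → if b then ℤ.+ 1 / 12 else ℤ.+ 1 / 8) (≡ᵇ-refl m)) ⟩
  sumBelow m (λ _ → ℤ.+ 1 / 8) + ℤ.+ 1 / 12
    ≡⟨ cong (_+ ℤ.+ 1 / 12) (sumBelow-const m (ℤ.+ 1 / 8)) ⟩
  toℚ m * (ℤ.+ 1 / 8) + ℤ.+ 1 / 12
    ∎)
  where open ≡-Reasoning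

-- The ladder 𝔾ₙ

σ : Fin 2 → ℚ
σ zero    = 1ℚ
σ (suc _) = - 1ℚ

½[1+σσ] : ∀ a s → ½ * (1ℚ + σ a * σ s) ≡ 𝟙 ⌊ a FinP.≟ s ⌋
½[1+σσ] zero       zero       = refl
½[1+σσ] zero       (suc zero) = refl
½[1+σσ] (suc zero) zero       = refl
½[1+σσ] (suc zero) (suc zero) = refl

⌊≟⌋≡≡ᵇ : ∀ {n} (i j : Fin n) → ⌊ i FinP.≟ j ⌋ ≡ (toℕ i ≡ᵇ toℕ j)
⌊≟⌋≡≡ᵇ zero    zero    = refl
⌊≟⌋≡≡ᵇ zero    (suc j) = refl
⌊≟⌋≡≡ᵇ (suc i) zero    = refl
⌊≟⌋≡≡ᵇ (suc i) (suc j) with i FinP.≟ j | ⌊≟⌋≡≡ᵇ i j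
... | yes _ | i≡ᵇj = i≡ᵇj
... | no  _ | i≡ᵇj = i≡ᵇj

module Ladder (m : ℕ) where
  open FinVertexSet (GVerts (suc m)) using (V; all; _≟_; Σᵥ)
  open Network (GVerts (suc m))

  sifting : Sifting
  sifting u f = sumList-pick _≟_ f (cartesianProduct⁺ (allFin⁺ (suc m)) (allFin⁺ 2))
                                   (∈-cartesianProduct⁺ (∈-allFin (proj₁ u)) (∈-allFin (proj₂ u)))

  blockEdges : Fin (suc m) → Fin (suc m) → List (Edge V)
  blockEdges i j = concatMap (λ a → map (λ b → edge (i , a) (j , b) 1ℚ) (allFin 2)) (allFin 2)

  rung : Edge V
  rung = edge (fromℕ m , zero) (fromℕ m , suc zero) 1ℚ

  loopless : All Loopless (GEdges m)
  loopless = ++⁺ (concat⁺ (map⁺ (tabulate⁺ block))) (rung-loopless ∷ rung-loopless ∷ [])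
    where
    distinct-layers : ∀ (k : Fin m) {a b} → ¬ (inject₁ k , a) ≡ (suc k , b)
    distinct-layers k eq = 1+n≢n (sym (trans (sym (FinP.toℕ-inject₁ k)) (cong (toℕ ∘ proj₁) eq)))
    block : ∀ k → All Loopless (blockEdges (inject₁ k) (suc k))
    block k = distinct-layers k ∷ distinct-layers k ∷ distinct-layers k ∷ distinct-layers k ∷ []
    rung-loopless : Loopless rung
    rung-loopless ()

  basis-ladder : ∀ i a K s → basis (GVerts (suc m)) (i , a) (K , s) ≡ 𝟙 (toℕ i ≡ᵇ toℕ K) * 𝟙 ⌊ a FinP.≟ s ⌋
  basis-ladder i a K s = trans (cong 𝟙 (≟-pair i K)) (𝟙-∧ (toℕ i ≡ᵇ toℕ K) ⌊ a FinP.≟ s ⌋)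
    where
    ≟-pair : ∀ i K → ⌊ (i , a) ≟ (K , s) ⌋ ≡ (toℕ i ≡ᵇ toℕ K) ∧ ⌊ a FinP.≟ s ⌋
    ≟-pair i K with i FinP.≟ K | ⌊≟⌋≡≡ᵇ i K
    ... | no  _    | i≡ᵇK = cong (_∧ ⌊ a FinP.≟ s ⌋) i≡ᵇK
    ... | yes refl | i≡ᵇK with a FinP.≟ s
    ...   | yes _ = cong (_∧ true) i≡ᵇK
    ...   | no  _ = cong (_∧ false) i≡ᵇK

  flow-ladder : ∀ e y K s → flow e y (K , s) ≡
      𝟙 (toℕ (proj₁ (Edge.end₁ e)) ≡ᵇ toℕ K) * 𝟙 ⌊ proj₂ (Edge.end₁ e) FinP.≟ s ⌋
        * (conductance e * (y (Edge.end₁ e) - y (Edge.end₂ e)))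
    + 𝟙 (toℕ (proj₁ (Edge.end₂ e)) ≡ᵇ toℕ K) * 𝟙 ⌊ proj₂ (Edge.end₂ e) FinP.≟ s ⌋
        * (conductance e * (y (Edge.end₂ e) - y (Edge.end₁ e)))
  flow-ladder e y K s =
    cong₂ _+_ (cong (_* (conductance e * (y (Edge.end₁ e) - y (Edge.end₂ e))))
                    (basis-ladder (proj₁ (Edge.end₁ e)) (proj₂ (Edge.end₁ e)) K s))
              (cong (_* (conductance e * (y (Edge.end₂ e) - y (Edge.end₁ e))))
                    (basis-ladder (proj₁ (Edge.end₂ e)) (proj₂ (Edge.end₂ e)) K s))

  block-flow : ∀ y i j K s → sumList (λ e → flow e y (K , s)) (blockEdges i j)
    ≡ 𝟙 (toℕ i ≡ᵇ toℕ K) * ((y (i , s) - y (j , zero)) + (y (i , s) - y (j , suc zero)))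
    + 𝟙 (toℕ j ≡ᵇ toℕ K) * ((y (j , s) - y (i , zero)) + (y (j , s) - y (i , suc zero)))
  block-flow y i j K zero       = trans (sumList-cong (blockEdges i j) (λ e → flow-ladder e y K zero))
    (four-edges₀ (𝟙 (toℕ i ≡ᵇ toℕ K)) (𝟙 (toℕ j ≡ᵇ toℕ K))
                 (y (i , zero)) (y (i , suc zero)) (y (j , zero)) (y (j , suc zero)))
    where
    four-edges₀ : ∀ p q i0 i1 j0 j1 →
        (p * 1ℚ * (1ℚ * (i0 - j0)) + q * 1ℚ * (1ℚ * (j0 - i0)))
      + ((p * 1ℚ * (1ℚ * (i0 - j1)) + q * 0ℚ * (1ℚ * (j1 - i0)))
      + ((p * 0ℚ * (1ℚ * (i1 - j0)) + q * 1ℚ * (1ℚ * (j0 - i1)))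
      + ((p * 0ℚ * (1ℚ * (i1 - j1)) + q * 0ℚ * (1ℚ * (j1 - i1))) + 0ℚ)))
      ≡ p * ((i0 - j0) + (i0 - j1)) + q * ((j0 - i0) + (j0 - i1))
    four-edges₀ = solve-∀ ℚ-ring
  block-flow y i j K (suc zero) = trans (sumList-cong (blockEdges i j) (λ e → flow-ladder e y K (suc zero)))
    (four-edges₁ (𝟙 (toℕ i ≡ᵇ toℕ K)) (𝟙 (toℕ j ≡ᵇ toℕ K))
                 (y (i , zero)) (y (i , suc zero)) (y (j , zero)) (y (j , suc zero)))
    where
    four-edges₁ : ∀ p q i0 i1 j0 j1 →
        (p * 0ℚ * (1ℚ * (i0 - j0)) + q * 0ℚ * (1ℚ * (j0 - i0)))
      + ((p * 0ℚ * (1ℚ * (i0 - j1)) + q * 1ℚ * (1ℚ * (j1 - i0)))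
      + ((p * 1ℚ * (1ℚ * (i1 - j0)) + q * 0ℚ * (1ℚ * (j0 - i1)))
      + ((p * 1ℚ * (1ℚ * (i1 - j1)) + q * 1ℚ * (1ℚ * (j1 - i1))) + 0ℚ)))
      ≡ p * ((i1 - j0) + (i1 - j1)) + q * ((j1 - i0) + (j1 - i1))
    four-edges₁ = solve-∀ ℚ-ring

  rung-flow : ∀ y K s → flow rung y (K , s) ≡ 𝟙 (m ≡ᵇ toℕ K) * (σ s * (y (fromℕ m , zero) - y (fromℕ m , suc zero)))
  rung-flow y K s = trans (flow-ladder rung y K s)
    (trans (by-side s (𝟙 (toℕ (fromℕ m) ≡ᵇ toℕ K)) (y (fromℕ m , zero)) (y (fromℕ m , suc zero)))
           (cong (λ t → 𝟙 (t ≡ᵇ toℕ K) * (σ s * (y (fromℕ m , zero) - y (fromℕ m , suc zero)))) (FinP.toℕ-fromℕ m)))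
    where
    by-side : ∀ s r y0 y1 → r * 𝟙 ⌊ zero FinP.≟ s ⌋ * (1ℚ * (y0 - y1)) + r * 𝟙 ⌊ suc zero FinP.≟ s ⌋ * (1ℚ * (y1 - y0))
                            ≡ r * (σ s * (y0 - y1))
    by-side zero       = solve-∀ ℚ-ring
    by-side (suc zero) = solve-∀ ℚ-ring

  Σᵥ-layers : ∀ (F : ℕ → Fin 2 → ℚ) →
              Σᵥ (λ v → F (toℕ (proj₁ v)) (proj₂ v)) ≡ sumBelow (suc m) (λ K → F K zero + F K (suc zero))
  Σᵥ-layers F =
    trans (sumList-cartesianProduct (λ v → F (toℕ (proj₁ v)) (proj₂ v)) (allFin (suc m)) (allFin 2))
          (trans (sumList-cong (allFin (suc m)) (λ k → cong (F (toℕ k) zero +_) (ℚ.+-identityʳ (F (toℕ k) (suc zero)))))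
                 (sumList-allFin (suc m) (λ K → F K zero + F K (suc zero))))

  layered : (ℕ → ℚ) → (ℕ → ℚ) → V → ℚ
  layered f g (K , s) = f (toℕ K) + σ s * g (toℕ K)

  module _ (f g : ℕ → ℚ) (K : Fin (suc m)) (s : Fin 2) where
    private
      y : V → ℚ
      y = layered f g
      K′ : ℕ
      K′ = toℕ K
      out into : ℕ → ℚ
      out  j = f j - f (suc j) + σ s * g j
      into j = f j - f (ℕ.pred j) + σ s * g j

    layerBlock-flow : ∀ k → sumList (λ e → flow e y (K , s)) (blockEdges (inject₁ k) (suc k))
                            ≡ 𝟙 (toℕ k ≡ᵇ K′) * (toℚ 2 * out (toℕ k))
                            + 𝟙 (suc (toℕ k) ≡ᵇ K′) * (toℚ 2 * into (suc (toℕ k)))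
    layerBlock-flow k = begin
      sumList (λ e → flow e y (K , s)) (blockEdges (inject₁ k) (suc k))
        ≡⟨ block-flow y (inject₁ k) (suc k) K s ⟩
      𝟙 (i ≡ᵇ K′) * ((y (inject₁ k , s) - y (suc k , zero)) + (y (inject₁ k , s) - y (suc k , suc zero)))
        + 𝟙 (j ≡ᵇ K′) * ((y (suc k , s) - y (inject₁ k , zero)) + (y (suc k , s) - y (inject₁ k , suc zero)))
        ≡⟨ cong₂ _+_ (cong (𝟙 (i ≡ᵇ K′) *_) (two-sides (f i) (f j) (σ s) (g i) (g j)))
                     (cong (𝟙 (j ≡ᵇ K′) *_) (two-sides (f j) (f i) (σ s) (g j) (g i))) ⟩
      𝟙 (i ≡ᵇ K′) * (toℚ 2 * (f i - f j + σ s * g i)) + 𝟙 (j ≡ᵇ K′) * (toℚ 2 * (f j - f i + σ s * g j))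
        ≡⟨ cong (λ i → 𝟙 (i ≡ᵇ K′) * (toℚ 2 * (f i - f j + σ s * g i))
                      + 𝟙 (j ≡ᵇ K′) * (toℚ 2 * (f j - f i + σ s * g j)))
                (FinP.toℕ-inject₁ k) ⟩
      𝟙 (toℕ k ≡ᵇ K′) * (toℚ 2 * out (toℕ k)) + 𝟙 (j ≡ᵇ K′) * (toℚ 2 * into j)
        ∎
      where
      open ≡-Reasoning
      i j : ℕ
      i = toℕ (inject₁ k)
      j = suc (toℕ k)
      two-sides : ∀ fi fj σs gi gj → ((fi + σs * gi) - (fj + 1ℚ * gj)) + ((fi + σs * gi) - (fj + - 1ℚ * gj))
                                     ≡ toℚ 2 * (fi - fj + σs * gi)
      two-sides = solve-∀ ℚ-ring

    layerBlocks-flow : sumList (λ e → flow e y (K , s)) (concatMap (λ k → blockEdges (inject₁ k) (suc k)) (allFin m))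
                       ≡ 𝟙 (K′ <ᵇ m) * (toℚ 2 * out K′) + 𝟙 (0 <ᵇ K′) * (toℚ 2 * into K′)
    layerBlocks-flow = begin
      sumList (λ e → flow e y (K , s)) (concatMap (λ k → blockEdges (inject₁ k) (suc k)) (allFin m))
        ≡⟨ sumList-concatMap (λ e → flow e y (K , s)) (λ k → blockEdges (inject₁ k) (suc k)) (allFin m) ⟩
      sumList (λ k → sumList (λ e → flow e y (K , s)) (blockEdges (inject₁ k) (suc k))) (allFin m)
        ≡⟨ sumList-cong (allFin m) layerBlock-flow ⟩
      sumList (F ∘ toℕ) (allFin m)
        ≡⟨ sumList-allFin m F ⟩
      sumBelow m F
        ≡⟨ sumBelow-+ m (λ j → 𝟙 (j ≡ᵇ K′) * (toℚ 2 * out j)) (λ j → 𝟙 (suc j ≡ᵇ K′) * (toℚ 2 * into (suc j))) ⟩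
      sumBelow m (λ j → 𝟙 (j ≡ᵇ K′) * (toℚ 2 * out j)) + sumBelow m (λ j → 𝟙 (suc j ≡ᵇ K′) * (toℚ 2 * into (suc j)))
        ≡⟨ cong₂ _+_ (sumBelow-select m K′ (λ j → toℚ 2 * out j))
                     (sumBelow-select-suc m K′ (λ j → toℚ 2 * into j) (FinP.toℕ≤pred[n] K)) ⟩
      𝟙 (K′ <ᵇ m) * (toℚ 2 * out K′) + 𝟙 (0 <ᵇ K′) * (toℚ 2 * into K′)
        ∎
      where
      open ≡-Reasoning
      F : ℕ → ℚ
      F j = 𝟙 (j ≡ᵇ K′) * (toℚ 2 * out j) + 𝟙 (suc j ≡ᵇ K′) * (toℚ 2 * into (suc j))

    rungs-flow : flow rung y (K , s) + (flow rung y (K , s) + 0ℚ) ≡ toℚ 4 * (𝟙 (m ≡ᵇ K′) * (σ s * g K′))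
    rungs-flow = begin
      flow rung y (K , s) + (flow rung y (K , s) + 0ℚ)
        ≡⟨ cong (λ t → t + (t + 0ℚ)) (trans (rung-flow y K s) (cong (λ d → 𝟙 (m ≡ᵇ K′) * (σ s * d)) rung-drop)) ⟩
      𝟙 (m ≡ᵇ K′) * (σ s * (toℚ 2 * g m)) + (𝟙 (m ≡ᵇ K′) * (σ s * (toℚ 2 * g m)) + 0ℚ)
        ≡⟨ cong (λ t → t + (t + 0ℚ)) (𝟙≡ᵇ-subst m K′ (λ j → σ s * (toℚ 2 * g j))) ⟩
      𝟙 (m ≡ᵇ K′) * (σ s * (toℚ 2 * g K′)) + (𝟙 (m ≡ᵇ K′) * (σ s * (toℚ 2 * g K′)) + 0ℚ)
        ≡⟨ double (𝟙 (m ≡ᵇ K′)) (σ s) (g K′) ⟩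
      toℚ 4 * (𝟙 (m ≡ᵇ K′) * (σ s * g K′))
        ∎
      where
      open ≡-Reasoning
      same-layer : ∀ x z → (x + 1ℚ * z) - (x + - 1ℚ * z) ≡ toℚ 2 * z
      same-layer = solve-∀ ℚ-ring
      double : ∀ r σs t → r * (σs * (toℚ 2 * t)) + (r * (σs * (toℚ 2 * t)) + 0ℚ) ≡ toℚ 4 * (r * (σs * t))
      double = solve-∀ ℚ-ring
      rung-drop : y (fromℕ m , zero) - y (fromℕ m , suc zero) ≡ toℚ 2 * g m
      rung-drop = trans (same-layer (f (toℕ (fromℕ m))) (g (toℕ (fromℕ m)))) (cong (λ j → toℚ 2 * g j) (FinP.toℕ-fromℕ m))

    laplacian-layered : (GLaplacian m ▸ layered f g) (K , s) ≡ toℚ 2 * pathLaplacian m f K′ + twist m K′ * (σ s * g K′)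
    laplacian-layered = begin
      (GLaplacian m ▸ y) (K , s)
        ≡⟨ laplacian-▸ sifting loopless y (K , s) ⟩
      sumList (λ e → flow e y (K , s)) (GEdges m)
        ≡⟨ sumList-++ (λ e → flow e y (K , s)) (concatMap (λ k → blockEdges (inject₁ k) (suc k)) (allFin m)) (rung ∷ rung ∷ []) ⟩
      sumList (λ e → flow e y (K , s)) (concatMap (λ k → blockEdges (inject₁ k) (suc k)) (allFin m))
        + (flow rung y (K , s) + (flow rung y (K , s) + 0ℚ))
        ≡⟨ cong₂ _+_ layerBlocks-flow rungs-flow ⟩
      𝟙 (K′ <ᵇ m) * (toℚ 2 * out K′) + 𝟙 (0 <ᵇ K′) * (toℚ 2 * into K′) + toℚ 4 * (𝟙 (m ≡ᵇ K′) * (σ s * g K′))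
        ≡⟨ collect (𝟙 (K′ <ᵇ m)) (𝟙 (0 <ᵇ K′)) (𝟙 (m ≡ᵇ K′)) (f K′) (f (suc K′)) (f (ℕ.pred K′)) (σ s) (g K′) ⟩
      toℚ 2 * pathLaplacian m f K′ + twist m K′ * (σ s * g K′)
        ∎
      where
      open ≡-Reasoning
      collect : ∀ p q r a b c σs t →
        p * (toℚ 2 * (a - b + σs * t)) + q * (toℚ 2 * (a - c + σs * t)) + toℚ 4 * (r * (σs * t))
          ≡ toℚ 2 * (p * (a - b) + q * (a - c)) + (toℚ 2 * p + toℚ 2 * q + toℚ 4 * r) * (σs * t)
      collect = solve-∀ ℚ-ring

  root : V
  root = (zero , zero)

  oddPart : ℕ → Fin 2 → ℕ → ℚ
  oddPart I a K = 𝟙 (I ≡ᵇ K) * (σ a * amplitude m I) - 𝟙 (0 ≡ᵇ K) * amplitude m 0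

  potential : V → V → ℚ
  potential (I , a) = layered (λ K → ¼ * toℚ (K ⊓ toℕ I)) (oddPart (toℕ I) a)

  potential-equation : ∀ u x → (GLaplacian m ▸ potential u) x
                               ≡ basis (GVerts (suc m)) u x - basis (GVerts (suc m)) root x
  potential-equation (I , a) (K , s) = begin
    (GLaplacian m ▸ potential (I , a)) (K , s)
      ≡⟨ laplacian-layered (λ k → ¼ * toℚ (k ⊓ I′)) α K s ⟩
    toℚ 2 * pathLaplacian m (λ k → ¼ * toℚ (k ⊓ I′)) K′ + twist m K′ * (σ s * α K′)
      ≡⟨ cong₂ (λ p t → toℚ 2 * p + t)
               (trans (pathLaplacian-*ˡ m ¼ (λ k → toℚ (k ⊓ I′)) K′) (cong (¼ *_) (pathLaplacian-⊓ (FinP.toℕ≤pred[n] I) K′)))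
               (trans (left-commute (twist m K′) (σ s) (α K′)) (cong (σ s *_) (twist-odd m I′ K′ (σ a) (FinP.toℕ≤pred[n] K)))) ⟩
    toℚ 2 * (¼ * (𝟙 (I′ ≡ᵇ K′) - 𝟙 (0 ≡ᵇ K′))) + σ s * (𝟙 (I′ ≡ᵇ K′) * (σ a * ½) - 𝟙 (0 ≡ᵇ K′) * ½)
      ≡⟨ regroup (𝟙 (I′ ≡ᵇ K′)) (𝟙 (0 ≡ᵇ K′)) (σ a) (σ s) ⟩
    𝟙 (I′ ≡ᵇ K′) * (½ * (1ℚ + σ a * σ s)) - 𝟙 (0 ≡ᵇ K′) * (½ * (1ℚ + σ zero * σ s))
      ≡⟨ cong₂ (λ p q → 𝟙 (I′ ≡ᵇ K′) * p - 𝟙 (0 ≡ᵇ K′) * q) (½[1+σσ] a s) (½[1+σσ] zero s) ⟩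
    𝟙 (I′ ≡ᵇ K′) * 𝟙 ⌊ a FinP.≟ s ⌋ - 𝟙 (0 ≡ᵇ K′) * 𝟙 ⌊ zero FinP.≟ s ⌋
      ≡⟨ sym (cong₂ _-_ (basis-ladder I a K s) (basis-ladder zero zero K s)) ⟩
    basis (GVerts (suc m)) (I , a) (K , s) - basis (GVerts (suc m)) root (K , s)
      ∎
    where
    open ≡-Reasoning
    I′ K′ : ℕ
    I′ = toℕ I
    K′ = toℕ K
    α : ℕ → ℚ
    α = oddPart I′ a
    left-commute : ∀ t σs x → t * (σs * x) ≡ σs * (t * x)
    left-commute = solve-∀ ℚ-ring
    regroup : ∀ p q σa σs → toℚ 2 * (¼ * (p - q)) + σs * (p * (σa * ½) - q * ½)
                            ≡ p * (½ * (1ℚ + σa * σs)) - q * (½ * (1ℚ + 1ℚ * σs))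
    regroup = solve-∀ ℚ-ring

  vertexCount : #V ≡ toℚ (suc m) * toℚ 2
  vertexCount = trans (Σᵥ-layers (λ _ _ → 1ℚ)) (sumBelow-const (suc m) (1ℚ + 1ℚ))

  diagonalSum : Σᵥ (λ u → potential u u) ≡ sumBelow (suc m) (λ I → ½ * toℚ I + toℚ 2 * amplitude m I)
  diagonalSum =
    trans (Σᵥ-layers (λ I a → ¼ * toℚ (I ⊓ I) + σ a * oddPart I a I))
          (sumBelow-cong (suc m) (λ I _ →
            trans (cong₂ (λ x b → (¼ * toℚ x + 1ℚ * (𝟙 b * (1ℚ * amplitude m I) - 𝟙 (0 ≡ᵇ I) * amplitude m 0))
                                + (¼ * toℚ x + - 1ℚ * (𝟙 b * (- 1ℚ * amplitude m I) - 𝟙 (0 ≡ᵇ I) * amplitude m 0)))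
                         (⊓-idem I) (≡ᵇ-refl I))
                  (both-sides (toℚ I) (amplitude m I) (𝟙 (0 ≡ᵇ I) * amplitude m 0))))
    where
    both-sides : ∀ x A B → (¼ * x + 1ℚ * (1ℚ * (1ℚ * A) - B)) + (¼ * x + - 1ℚ * (1ℚ * (- 1ℚ * A) - B)) ≡ ½ * x + toℚ 2 * A
    both-sides = solve-∀ ℚ-ring

  totalSum : Σᵥ (λ u → Σᵥ (potential u)) ≡ sumBelow (suc m) (λ I → sumBelow (suc m) (λ K → toℚ (K ⊓ I)))
  totalSum = begin
    Σᵥ (λ u → Σᵥ (potential u))
      ≡⟨ sumList-cong all row ⟩
    Σᵥ (λ u → S (toℕ (proj₁ u)))
      ≡⟨ Σᵥ-layers (λ I _ → S I) ⟩
    sumBelow (suc m) (λ I → S I + S I)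
      ≡⟨ sumBelow-cong (suc m) (λ I _ → trans (cong (λ x → x + x) (sumBelow-*ˡ (suc m) ½ (λ K → toℚ (K ⊓ I))))
                                              (halves (sumBelow (suc m) (λ K → toℚ (K ⊓ I))))) ⟩
    sumBelow (suc m) (λ I → sumBelow (suc m) (λ K → toℚ (K ⊓ I)))
      ∎
    where
    open ≡-Reasoning
    S : ℕ → ℚ
    S I = sumBelow (suc m) (λ K → ½ * toℚ (K ⊓ I))
    odd-cancels : ∀ x a → (¼ * x + 1ℚ * a) + (¼ * x + - 1ℚ * a) ≡ ½ * x
    odd-cancels = solve-∀ ℚ-ring
    halves : ∀ x → ½ * x + ½ * x ≡ x
    halves = solve-∀ ℚ-ring
    row : ∀ u → Σᵥ (potential u) ≡ S (toℕ (proj₁ u))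
    row (I , a) =
      trans (Σᵥ-layers (λ K s → ¼ * toℚ (K ⊓ toℕ I) + σ s * oddPart (toℕ I) a K))
            (sumBelow-cong (suc m) (λ K _ → odd-cancels (toℚ (K ⊓ toℕ I)) (oddPart (toℕ I) a K)))

toℚᵘ-toℚ : ∀ N → toℚᵘ (toℚ N) ≃ᵘ mkℚᵘ (ℤ.+ N) 0
toℚᵘ-toℚ zero    = ℚᵘ.≃-refl
toℚᵘ-toℚ (suc N) =
  ℚᵘ.≃-trans (ℚ.toℚᵘ-homo-+ 1ℚ (toℚ N))
             (ℚᵘ.≃-trans (ℚᵘ.+-congʳ (toℚᵘ 1ℚ) (toℚᵘ-toℚ N)) (*≡* (cross (ℤ.+ N))))
  where
  cross : ∀ n → (ℤ.+ 1 ℤ.* ℤ.+ 1 ℤ.+ n ℤ.* ℤ.+ 1) ℤ.* ℤ.+ 1 ≡ (ℤ.+ 1 ℤ.+ n) ℤ.* (ℤ.+ 1 ℤ.* ℤ.+ 1)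
  cross = ℤ-solve

toℚ*⅙ : ∀ N → toℚ N * (ℤ.+ 1 / 6) ≡ ℤ.+ N / 6
toℚ*⅙ N = trans (sym (ℚ.fromℚᵘ-toℚᵘ (toℚ N * (ℤ.+ 1 / 6)))) (ℚ.fromℚᵘ-cong unnormalised)
  where
  cross : ∀ n → (n ℤ.* ℤ.+ 1) ℤ.* ℤ.+ 6 ≡ n ℤ.* (ℤ.+ 1 ℤ.* ℤ.+ 6)
  cross = ℤ-solve
  unnormalised : toℚᵘ (toℚ N * (ℤ.+ 1 / 6)) ≃ᵘ mkℚᵘ (ℤ.+ N) 5
  unnormalised = ℚᵘ.≃-trans (ℚ.toℚᵘ-homo-* (toℚ N) (ℤ.+ 1 / 6))
                            (ℚᵘ.≃-trans (ℚᵘ.*-congʳ {toℚᵘ (ℤ.+ 1 / 6)} (toℚᵘ-toℚ N)) (*≡* (cross (ℤ.+ N))))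

toℚ-cubic : ∀ n → toℚ (n ℕ.^ 3 ℕ.+ 3 ℕ.* n ℕ.^ 2 ℕ.+ n)
                  ≡ toℚ n * (toℚ n * (toℚ n * 1ℚ)) + toℚ 3 * (toℚ n * (toℚ n * 1ℚ)) + toℚ n
toℚ-cubic n =
  trans (toℚ-+ (n ℕ.^ 3 ℕ.+ 3 ℕ.* n ℕ.^ 2) n)
        (cong (_+ toℚ n) (trans (toℚ-+ (n ℕ.^ 3) (3 ℕ.* n ℕ.^ 2))
                                (cong₂ _+_ (trans (toℚ-* n (n ℕ.^ 2)) (cong (toℚ n *_) square))
                                           (trans (toℚ-* 3 (n ℕ.^ 2)) (cong (toℚ 3 *_) square)))))
  where
  square : toℚ (n ℕ.^ 2) ≡ toℚ n * (toℚ n * 1ℚ)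
  square = trans (toℚ-* n (n ℕ.* 1)) (cong (toℚ n *_) (toℚ-* n 1))

kirchhoff-closedForm : ∀ m →
  toℚ (suc m) * toℚ 2 * sumBelow (suc m) (λ I → ½ * toℚ I + toℚ 2 * amplitude m I)
    - sumBelow (suc m) (λ I → sumBelow (suc m) (λ K → toℚ (K ⊓ I)))
  ≡ kfFormula (suc m)
kirchhoff-closedForm zero    = refl
kirchhoff-closedForm (suc m) = begin
  N * sumBelow n (λ I → ½ * toℚ I + toℚ 2 * amplitude (suc m) I) - G
    ≡⟨ cong (λ d → N * d - G) (trans (sumBelow-+ n (λ I → ½ * toℚ I) (λ I → toℚ 2 * amplitude (suc m) I))
                                     (cong₂ _+_ (sumBelow-*ˡ n ½ toℚ)
                                                (trans (sumBelow-*ˡ n (toℚ 2) (amplitude (suc m)))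
                                                       (cong (toℚ 2 *_) (sumBelow-amplitude m))))) ⟩
  N * (½ * S + toℚ 2 * Amp) - G
    ≡⟨ rescale N S Amp G ⟩
  N * (¼ * (toℚ 2 * S) + toℚ 2 * Amp) - ⅙ * (toℚ 6 * G)
    ≡⟨ cong₂ (λ s g → N * (¼ * s + toℚ 2 * Amp) - ⅙ * g) (sumBelow-toℚ n) (sumBelow-⊓ n) ⟩
  N * (¼ * (toℚ n * (toℚ n - 1ℚ)) + toℚ 2 * Amp) - ⅙ * ((toℚ n - 1ℚ) * toℚ n * (toℚ 2 * toℚ n - 1ℚ))
    ≡⟨ cubic (toℚ m) ⟩
  (toℚ n * (toℚ n * (toℚ n * 1ℚ)) + toℚ 3 * (toℚ n * (toℚ n * 1ℚ)) + toℚ n) * ⅙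
    ≡⟨ cong (_* ⅙) (sym (toℚ-cubic n)) ⟩
  toℚ (n ℕ.^ 3 ℕ.+ 3 ℕ.* n ℕ.^ 2 ℕ.+ n) * ⅙
    ≡⟨ toℚ*⅙ (n ℕ.^ 3 ℕ.+ 3 ℕ.* n ℕ.^ 2 ℕ.+ n) ⟩
  kfFormula n
    ∎
  where
  open ≡-Reasoning
  n : ℕ
  n = suc (suc m)
  N S G Amp ⅙ : ℚ
  N = toℚ n * toℚ 2
  S = sumBelow n toℚ
  G = sumBelow n (λ I → sumBelow n (λ K → toℚ (K ⊓ I)))
  Amp = ¼ + (toℚ m * (ℤ.+ 1 / 8) + ℤ.+ 1 / 12)
  ⅙ = ℤ.+ 1 / 6
  rescale : ∀ p q a r → p * (½ * q + toℚ 2 * a) - r ≡ p * (¼ * (toℚ 2 * q) + toℚ 2 * a) - ⅙ * (toℚ 6 * r)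
  rescale = solve-∀ ℚ-ring
  cubic : ∀ x → let t = 1ℚ + (1ℚ + x) in
    t * toℚ 2 * (¼ * (t * (t - 1ℚ)) + toℚ 2 * (¼ + (x * (ℤ.+ 1 / 8) + ℤ.+ 1 / 12)))
      - ⅙ * ((t - 1ℚ) * t * (toℚ 2 * t - 1ℚ))
    ≡ (t * (t * (t * 1ℚ)) + toℚ 3 * (t * (t * 1ℚ)) + t) * ⅙
  cubic = solve-∀ ℚ-ring

corollary3p3 : (m : ℕ) → (X : Matrix _) →
    IsMoorePenroseInverse (GVerts (suc m)) (GLaplacian m) X →
    kirchhoffIndex (GVerts (suc m)) X ≡ kfFormula (suc m)
corollary3p3 m X mp = begin
  kirchhoffIndex (GVerts (suc m)) X
    ≡⟨ kirchhoffIndex-grounded sifting (laplacian-symmetric (GEdges m)) (IsMoorePenroseInverse.p₁ mp)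
                                 potential root potential-equation ⟩
  #V * Σᵥ (λ u → potential u u) - Σᵥ (λ u → Σᵥ (potential u))
    ≡⟨ cong₂ _-_ (cong₂ _*_ vertexCount diagonalSum) totalSum ⟩
  toℚ (suc m) * toℚ 2 * sumBelow (suc m) (λ I → ½ * toℚ I + toℚ 2 * amplitude m I)
    - sumBelow (suc m) (λ I → sumBelow (suc m) (λ K → toℚ (K ⊓ I)))
    ≡⟨ kirchhoff-closedForm m ⟩
  kfFormula (suc m)
    ∎
  where
  open ≡-Reasoning
  open Ladder m
  open Network (GVerts (suc m))
  open FinVertexSet (GVerts (suc m)) using (Σᵥ)
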